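{- (Parabolic lemma.) For any computation $\omega$ of RMPC, there exist two forward computations $\omega_1$ and $\omega_2$ such that $\omega \asymp \overline{\omega_1}\,\omega_2$ and $|\omega_1| + |\omega_2| \le |\omega|$.
   Context: RMPC. Fix a countable set $\mathcal{A}$ of actions, rates in $\mathbb{R}_{>0}$, and a countable set $\mathcal{K}$ of keys. Forward processes: $P,Q ::= \mathbf{0} \mid \langle a,\lambda\rangle.P \mid P+Q \mid P\parallel_L Q$ ($L\subseteq\mathcal A$); reversible processes: $R,S ::= P \mid \langle a,\lambda\rangle[i].R \mid R+S \mid R\parallel_L S$ ($i\in\mathcal K$). $\mathrm{std}(R)$ means $R$ is a forward process; $\mathrm{key}(R)$ is the set of keys occurring in $R$. Every rate $\lambda$ has an associated backward rate $\overline{\lambda}>0$. Forward $\to$ and backward $\rightsquigarrow$ transition relations are the least relations closed under (symmetric variants of Cho, Par, Cho$^r$, Par$^r$ included): (Act1) if $\mathrm{std}(R)$ then $\langle a,\lambda\rangle.R \xrightarrow{\langle a,\lambda\rangle[i]} \langle a,\lambda\rangle[i].R$ for every $i\in\mathcal K$; (Act1$^r$) if $\mathrm{std}(R)$ then $\langle a,\lambda\rangle[i].R \rightsquigarrow^{\langle a,\overline\lambda\rangle[i]} \langle a,\lambda\rangle.R$. (Act2) if $R\xrightarrow{\langle b,\mu\rangle[j]}R'$ and $j\neq i$ then $\langle a,\lambda\rangle[i].R\xrightarrow{\langle b,\mu\rangle[j]}\langle a,\lambda\rangle[i].R'$; (Act2$^r$) the same with $\rightsquigarrow$ and label $\langle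 b,\overline\mu\rangle[j]$. (Cho) if $R\xrightarrow{\ell}R'$ and $\mathrm{std}(S)$ then $R+S\xrightarrow{\ell}R'+S$; (Cho$^r$) the same with $\rightsquigarrow$. (Par) if $R\xrightarrow{\langle a,\lambda\rangle[i]}R'$, $a\notin L$, $i\notin\mathrm{key}(S)$ then $R\parallel_L S\xrightarrow{\langle a,\lambda\rangle[i]}R'\parallel_L S$; (Par$^r$) the same with $\rightsquigarrow$. (Coo) if $R\xrightarrow{\langle a,\lambda\rangle[i]}R'$, $S\xrightarrow{\langle a,\mu\rangle[i]}S'$, $a\in L$ then $R\parallel_L S\xrightarrow{\langle a,\lambda\cdot\mu\rangle[i]}R'\parallel_L S'$; (Coo$^r$) if $R\rightsquigarrow^{\langle a,\overline\lambda\rangle[i]}R'$, $S\rightsquigarrow^{\langle a,\overline\mu\rangle[i]}S'$, $a\in L$ then $R\parallel_L S\rightsquigarrow^{\langle a,\overline\lambda\cdot\overline\mu\rangle[i]}R'\parallel_L S'$. $\mathcal P$ (reachable processes) = forward processes plus all processes obtained from them by finitely many forward transitions. A transition $R\mapsto^\ell S$ is an element of $\to\cup\rightsquigarrow$ with $R,S\in\mathcal P$; $R$ is its source, $S$ its target; coinitial = same source, cofinal = same target, composable = target of the first is source of the second. A computation is a finite sequence of pairwise composable transitions ($\epsilon$ the empty computation, $|\omega|$ its number of transitions, $\omega_1\omega_2$ composition). For a forward transition $\theta=R\xrightarrow{\langle a,\lambda\rangle[i]}S$, $\overline\theta = S\rightsquigarrow^{\langle a,\overline\lambda\rangle[i]}R$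 is the corresponding backward transition (where a synchronization rate $\lambda\cdot\mu$ corresponds to $\overline\lambda\cdot\overline\mu$); for a forward computation $\omega$, $\overline\omega$ is the backward computation undoing it in reverse order. Causal set: $\mathrm{cau}(P,i)=\emptyset$; $\mathrm{cau}(\langle a,\lambda\rangle[j].R,i)=\emptyset$ if $j=i$ or $i\notin\mathrm{key}(R)$, and $\{j\}\cup\mathrm{cau}(R,i)$ otherwise; $\mathrm{cau}(R+S,i)=\mathrm{cau}(R\parallel_L S,i)=\mathrm{cau}(R,i)\cup\mathrm{cau}(S,i)$. Process contexts: $\mathcal C ::= \bullet \mid \langle a,\lambda\rangle[i].\mathcal C \mid R+\mathcal C \mid \mathcal C+R \mid R\parallel_L\mathcal C \mid \mathcal C\parallel_L R$. Two coinitial transitions $\theta_1,\theta_2$ from $R$ are in conflict iff (1) $\theta_1 = R\xrightarrow{\langle a,\lambda\rangle[i]}S_1$, $\theta_2 = R\rightsquigarrow^{\langle b,\overline\mu\rangle[j]}S_2$ with $j\in\mathrm{cau}(S_1,i)$, or (2) $R=\mathcal C[P_1+P_2]$ and each $\theta_k$ ($k=1,2$) is derived from a forward transition $P_k\xrightarrow{\langle a_k,\lambda_k\rangle[i_k]}S_k$; they are concurrent iff not in conflict. Causal equivalence $\asymp$ is the smallest equivalence relation on computations closed under composition such that (1) $\theta_1\theta'_2\asymp\theta_2\theta'_1$ for any coinitial concurrent $\theta_1=R\mapsto^{\ell_1}R_1$, $\theta_2=R\mapsto^{\ell_2}R_2$ and cofinal $\theta'_2=R_1\mapsto^{\ell_2}S$,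 $\theta'_1=R_2\mapsto^{\ell_1}S$; (2) $\theta\overline\theta\asymp\epsilon$ and $\overline\theta\theta\asymp\epsilon$. -}

module Defs where

open import Data.Nat using (ℕ; _+_)
open import Data.Bool using (Bool; true; false)
open import Data.Product using (Σ; _×_; _,_)
open import Data.Sum using (_⊎_)
open import Relation.Nullary using (¬_)
open import Relation.Binary.PropositionalEquality using (_≡_; _≢_)
open import Function.Definitions using (Injective)

record Sig : Set₁ where
  field
    Act       : Set
    Key       : Set
    Rate      : Set
    _·_       : Rate → Rate → Rate
    bar       : Rate → Rate
    Act-countable : Σ (Act → ℕ) (Injective _≡_ _≡_)
    Key-countable : Σ (Key → ℕ) (Injective _≡_ _≡_)

module RMPC (sig : Sig) where
  open Sig sig

  infixr 6 _+ₚ_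
  infixr 5 _∥[_]_

  -- A synchronisation set L ⊆ 𝒜 is given by its
  -- characteristic function.  The grammar restriction that an unkeyed
  -- prefix only guards a forward process is imposed by 'Std'/'Reach'.
  data Proc : Set where
    𝟎       : Proc
    ⟨_,_⟩·_   : Act → Rate → Proc → Proc
    ⟨_,_⟩[_]·_ : Act → Rate → Key → Proc → Proc
    _+ₚ_     : Proc → Proc → Proc
    _∥[_]_   : Proc → (Act → Bool) → Proc → Proc

  data Std : Proc → Set where
    std𝟎 : Std 𝟎
    stdPre : ∀ {a r P} → Std P → Std (⟨ a , r ⟩· P)
    stdSum : ∀ {P Q} → Std P → Std Q → Std (P +ₚ Q)
    stdPar : ∀ {P Q L} → Std P → Std Q → Std (P ∥[ L ] Q)

  data _∈key_ (i : Key) : Proc → Set where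
    kHere : ∀ {a r R} → i ∈key (⟨ a , r ⟩[ i ]· R)
    kThere : ∀ {a r j R} → i ∈key R → i ∈key (⟨ a , r ⟩[ j ]· R)
    kPre : ∀ {a r R} → i ∈key R → i ∈key (⟨ a , r ⟩· R)
    kSumL : ∀ {R S} → i ∈key R → i ∈key (R +ₚ S)
    kSumR : ∀ {R S} → i ∈key S → i ∈key (R +ₚ S)
    kParL : ∀ {R S L} → i ∈key R → i ∈key (R ∥[ L ] S)
    kParR : ∀ {R S L} → i ∈key S → i ∈key (R ∥[ L ] S)

  data Label : Set where
    ⟨_,_⟩[_] : Act → Rate → Key → Label

  data _⟶[_]_ : Proc → Label → Proc → Set where
    act1 : ∀ {a r R} (i : Key) → .(Std R) →
           (⟨ a , r ⟩· R) ⟶[ ⟨ a , r ⟩[ i ] ] (⟨ a , r ⟩[ i ]· R)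
    act2 : ∀ {a r i b m j R R'} → R ⟶[ ⟨ b , m ⟩[ j ] ] R' → .(j ≢ i) →
           (⟨ a , r ⟩[ i ]· R) ⟶[ ⟨ b , m ⟩[ j ] ] (⟨ a , r ⟩[ i ]· R')
    choL : ∀ {R R' S ℓ} → R ⟶[ ℓ ] R' → .(Std S) → (R +ₚ S) ⟶[ ℓ ] (R' +ₚ S)
    choR : ∀ {R S S' ℓ} → S ⟶[ ℓ ] S' → .(Std R) → (R +ₚ S) ⟶[ ℓ ] (R +ₚ S')
    parL : ∀ {R R' S L a r i} → R ⟶[ ⟨ a , r ⟩[ i ] ] R' → .(L a ≡ false) → .(¬ (i ∈key S)) →
           (R ∥[ L ] S) ⟶[ ⟨ a , r ⟩[ i ] ] (R' ∥[ L ] S)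
    parR : ∀ {R S S' L a r i} → S ⟶[ ⟨ a , r ⟩[ i ] ] S' → .(L a ≡ false) → .(¬ (i ∈key R)) →
           (R ∥[ L ] S) ⟶[ ⟨ a , r ⟩[ i ] ] (R ∥[ L ] S')
    coo  : ∀ {R R' S S' L a r m i} → R ⟶[ ⟨ a , r ⟩[ i ] ] R' → S ⟶[ ⟨ a , m ⟩[ i ] ] S' →
           .(L a ≡ true) → (R ∥[ L ] S) ⟶[ ⟨ a , r · m ⟩[ i ] ] (R' ∥[ L ] S')

  -- backward transitions (the rate in a backward label is already a backward rate)
  data _⇝[_]_ : Proc → Label → Proc → Set where
    act1ʳ : ∀ {a r i R} → .(Std R) →
            (⟨ a , r ⟩[ i ]· R) ⇝[ ⟨ a , bar r ⟩[ i ] ] (⟨ a , r ⟩· R)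
    act2ʳ : ∀ {a r i b m j R R'} → R ⇝[ ⟨ b , m ⟩[ j ] ] R' → .(j ≢ i) →
            (⟨ a , r ⟩[ i ]· R) ⇝[ ⟨ b , m ⟩[ j ] ] (⟨ a , r ⟩[ i ]· R')
    choLʳ : ∀ {R R' S ℓ} → R ⇝[ ℓ ] R' → .(Std S) → (R +ₚ S) ⇝[ ℓ ] (R' +ₚ S)
    choRʳ : ∀ {R S S' ℓ} → S ⇝[ ℓ ] S' → .(Std R) → (R +ₚ S) ⇝[ ℓ ] (R +ₚ S')
    parLʳ : ∀ {R R' S L a r i} → R ⇝[ ⟨ a , r ⟩[ i ] ] R' → .(L a ≡ false) → .(¬ (i ∈key S)) →
            (R ∥[ L ] S) ⇝[ ⟨ a , r ⟩[ i ] ] (R' ∥[ L ] S)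
    parRʳ : ∀ {R S S' L a r i} → S ⇝[ ⟨ a , r ⟩[ i ] ] S' → .(L a ≡ false) → .(¬ (i ∈key R)) →
            (R ∥[ L ] S) ⇝[ ⟨ a , r ⟩[ i ] ] (R ∥[ L ] S')
    cooʳ  : ∀ {R R' S S' L a r m i} → R ⇝[ ⟨ a , r ⟩[ i ] ] R' → S ⇝[ ⟨ a , m ⟩[ i ] ] S' →
            .(L a ≡ true) → (R ∥[ L ] S) ⇝[ ⟨ a , r · m ⟩[ i ] ] (R' ∥[ L ] S')

  brate : ∀ {R S a r i} → R ⟶[ ⟨ a , r ⟩[ i ] ] S → Rate
  brate (act1 {r = r} _ _) = bar r
  brate (act2 d _) = brate d
  brate (choL d _) = brate d
  brate (choR d _) = brate d
  brate (parL d _ _) = brate d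
  brate (parR d _ _) = brate d
  brate (coo d e _) = brate d · brate e

  revD : ∀ {R S a r i} (d : R ⟶[ ⟨ a , r ⟩[ i ] ] S) → S ⇝[ ⟨ a , brate d ⟩[ i ] ] R
  revD (act1 _ s) = act1ʳ s
  revD (act2 d ne) = act2ʳ (revD d) ne
  revD (choL d s) = choLʳ (revD d) s
  revD (choR d s) = choRʳ (revD d) s
  revD (parL d p q) = parLʳ (revD d) p q
  revD (parR d p q) = parRʳ (revD d) p q
  revD (coo d e p) = cooʳ (revD d) (revD e) p

  data Reach : Proc → Set where
    base : ∀ {P} → Std P → Reach P
    step : ∀ {R ℓ S} → Reach R → R ⟶[ ℓ ] S → Reach S

  data Dir : Set where
    fwd bwd : Dir

  data Tr (R S : Proc) : Set where
    fw : ∀ {ℓ} → R ⟶[ ℓ ] S → .(Reach R) → .(Reach S) → Tr R S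
    bw : ∀ {ℓ} → R ⇝[ ℓ ] S → .(Reach R) → .(Reach S) → Tr R S

  kind : ∀ {R S} → Tr R S → Dir × Label
  kind (fw {ℓ} _ _ _) = fwd , ℓ
  kind (bw {ℓ} _ _ _) = bwd , ℓ

  bar-tr : ∀ {R S a r i} → R ⟶[ ⟨ a , r ⟩[ i ] ] S → .(Reach R) → .(Reach S) → Tr S R
  bar-tr d rR rS = bw (revD d) rS rR

  infixr 5 _∷_ _++_
  data Comp : Proc → Proc → Set where
    ε   : ∀ {R} → Comp R R
    _∷_ : ∀ {R S T} → Tr R S → Comp S T → Comp R T

  _++_ : ∀ {R S T} → Comp R S → Comp S T → Comp R T
  ε ++ ω' = ω'
  (θ ∷ ω) ++ ω' = θ ∷ (ω ++ ω')

  ∣_∣ : ∀ {R S} → Comp R S → ℕ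
  ∣ ε ∣ = 0
  ∣ θ ∷ ω ∣ = 1 + ∣ ω ∣

  data FComp : Proc → Proc → Set where
    ε   : ∀ {R} → FComp R R
    _∷_ : ∀ {R S T a r i} → (Σ (R ⟶[ ⟨ a , r ⟩[ i ] ] S) λ _ → Reach R × Reach S) → FComp S T → FComp R T

  toComp : ∀ {R S} → FComp R S → Comp R S
  toComp ε = ε
  toComp ((d , rR , rS) ∷ ω) = fw d rR rS ∷ toComp ω

  ∣_∣f : ∀ {R S} → FComp R S → ℕ
  ∣ ω ∣f = ∣ toComp ω ∣

  barC : ∀ {R S} → FComp R S → Comp S R
  barC ε = ε
  barC ((d , rR , rS) ∷ ω) = barC ω ++ (bar-tr d rR rS ∷ ε)

  -- causal set, as a membership predicate: j ∈ cau(R , i)  is  InCau j R i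
  data InCau (k : Key) : Proc → Key → Set where
    cPre : ∀ {a r j R i} → j ≢ i → i ∈key R → (k ≡ j ⊎ InCau k R i) → InCau k (⟨ a , r ⟩[ j ]· R) i
    cSumL : ∀ {R S i} → InCau k R i → InCau k (R +ₚ S) i
    cSumR : ∀ {R S i} → InCau k S i → InCau k (R +ₚ S) i
    cParL : ∀ {R S L i} → InCau k R i → InCau k (R ∥[ L ] S) i
    cParR : ∀ {R S L i} → InCau k S i → InCau k (R ∥[ L ] S) i

  data Ctx : Set where
    • : Ctx
    ctxPre : Act → Rate → Key → Ctx → Ctx
    ctxSumR : Proc → Ctx → Ctx
    ctxSumL : Ctx → Proc → Ctx
    ctxParR : Proc → (Act → Bool) → Ctx → Ctx
    ctxParL : Ctx → (Act → Bool) → Proc → Ctx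

  plug : Ctx → Proc → Proc
  plug • P = P
  plug (ctxPre a r i C) P = ⟨ a , r ⟩[ i ]· plug C P
  plug (ctxSumR R C) P = R +ₚ plug C P
  plug (ctxSumL C R) P = plug C P +ₚ R
  plug (ctxParR R L C) P = R ∥[ L ] plug C P
  plug (ctxParL C L R) P = plug C P ∥[ L ] R

  data Side : Set where
    left right : Side

  -- Via C s d : the source of d is 𝒞[P₁ + P₂] (P₁, P₂ forward) and the
  -- forward transition d is derived from a forward transition of P₁ (s = left)
  -- resp. P₂ (s = right) at the hole of 𝒞.
  data Via : Ctx → Side → ∀ {R ℓ S} → R ⟶[ ℓ ] S → Set where
    hereL : ∀ {P₁ P₂ ℓ S₁} {d : P₁ ⟶[ ℓ ] S₁} → Std P₁ → (s₂ : Std P₂) → Via • left (choL {S = P₂} d s₂)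
    hereR : ∀ {P₁ P₂ ℓ S₂} {d : P₂ ⟶[ ℓ ] S₂} → (s₁ : Std P₁) → Std P₂ → Via • right (choR {R = P₁} d s₁)
    vPre : ∀ {C s a r i b m j R R'} {d : R ⟶[ ⟨ b , m ⟩[ j ] ] R'} .{ne : j ≢ i} →
           Via C s d → Via (ctxPre a r i C) s (act2 {a = a} {r = r} d ne)
    vSumR : ∀ {C s Q S S' ℓ} {d : S ⟶[ ℓ ] S'} .{st : Std Q} →
            Via C s d → Via (ctxSumR Q C) s (choR {R = Q} d st)
    vSumL : ∀ {C s Q R R' ℓ} {d : R ⟶[ ℓ ] R'} .{st : Std Q} →
            Via C s d → Via (ctxSumL C Q) s (choL {S = Q} d st)
    vParL : ∀ {C s Q L R R' a r i} {d : R ⟶[ ⟨ a , r ⟩[ i ] ] R'} .{p : L a ≡ false} .{q : ¬ (i ∈key Q)} →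
            Via C s d → Via (ctxParL C L Q) s (parL {S = Q} {L = L} d p q)
    vParR : ∀ {C s Q L S S' a r i} {d : S ⟶[ ⟨ a , r ⟩[ i ] ] S'} .{p : L a ≡ false} .{q : ¬ (i ∈key Q)} →
            Via C s d → Via (ctxParR Q L C) s (parR {R = Q} {L = L} d p q)
    vCooL : ∀ {C s L R R' S S' a r m i} {d : R ⟶[ ⟨ a , r ⟩[ i ] ] R'} {e : S ⟶[ ⟨ a , m ⟩[ i ] ] S'}
            .{p : L a ≡ true} → Via C s d → Via (ctxParL C L S) s (coo {L = L} d e p)
    vCooR : ∀ {C s L R R' S S' a r m i} {d : R ⟶[ ⟨ a , r ⟩[ i ] ] R'} {e : S ⟶[ ⟨ a , m ⟩[ i ] ] S'}
            .{p : L a ≡ true} → Via C s e → Via (ctxParR R L C) s (coo {L = L} d e p)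

  data Conflict {R : Proc} : ∀ {S₁ S₂} → Tr R S₁ → Tr R S₂ → Set where
    conf1 : ∀ {S₁ S₂ a r i b m j} {d₁ : R ⟶[ ⟨ a , r ⟩[ i ] ] S₁} {d₂ : R ⇝[ ⟨ b , m ⟩[ j ] ] S₂}
            .{x₁ : Reach R} .{y₁ : Reach S₁} .{x₂ : Reach R} .{y₂ : Reach S₂} →
            InCau j S₁ i → Conflict (fw d₁ x₁ y₁) (bw d₂ x₂ y₂)
    conf1' : ∀ {S₁ S₂ a r i b m j} {d₁ : R ⟶[ ⟨ a , r ⟩[ i ] ] S₁} {d₂ : R ⇝[ ⟨ b , m ⟩[ j ] ] S₂}
            .{x₁ : Reach R} .{y₁ : Reach S₁} .{x₂ : Reach R} .{y₂ : Reach S₂} →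
            InCau j S₁ i → Conflict (bw d₂ x₂ y₂) (fw d₁ x₁ y₁)
    conf2 : ∀ {S₁ S₂ ℓ₁ ℓ₂} {d₁ : R ⟶[ ℓ₁ ] S₁} {d₂ : R ⟶[ ℓ₂ ] S₂}
            .{x₁ : Reach R} .{y₁ : Reach S₁} .{x₂ : Reach R} .{y₂ : Reach S₂}
            (C : Ctx) {s₁ s₂ : Side} → s₁ ≢ s₂ → Via C s₁ d₁ → Via C s₂ d₂ →
            Conflict (fw d₁ x₁ y₁) (fw d₂ x₂ y₂)

  Concurrent : ∀ {R S₁ S₂} → Tr R S₁ → Tr R S₂ → Set
  Concurrent θ₁ θ₂ = ¬ Conflict θ₁ θ₂

  infix 4 _≍_
  data _≍_ : ∀ {R S} → Comp R S → Comp R S → Set where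
    ≍-refl  : ∀ {R S} {ω : Comp R S} → ω ≍ ω
    ≍-sym   : ∀ {R S} {ω ω' : Comp R S} → ω ≍ ω' → ω' ≍ ω
    ≍-trans : ∀ {R S} {ω ω' ω'' : Comp R S} → ω ≍ ω' → ω' ≍ ω'' → ω ≍ ω''
    ≍-comp  : ∀ {R S T} {ω₁ ω₂ : Comp R S} {ω₁' ω₂' : Comp S T} →
              ω₁ ≍ ω₂ → ω₁' ≍ ω₂' → (ω₁ ++ ω₁') ≍ (ω₂ ++ ω₂')
    ≍-swap  : ∀ {R R₁ R₂ S} (θ₁ : Tr R R₁) (θ₂ : Tr R R₂) (θ₂' : Tr R₁ S) (θ₁' : Tr R₂ S) →
              Concurrent θ₁ θ₂ → kind θ₁' ≡ kind θ₁ → kind θ₂' ≡ kind θ₂ →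
              (θ₁ ∷ θ₂' ∷ ε) ≍ (θ₂ ∷ θ₁' ∷ ε)
    ≍-cancel : ∀ {R S a r i} (d : R ⟶[ ⟨ a , r ⟩[ i ] ] S) .(rR : Reach R) .(rS : Reach S) →
              (fw d rR rS ∷ bar-tr d rR rS ∷ ε) ≍ ε
    ≍-cancel' : ∀ {R S a r i} (d : R ⟶[ ⟨ a , r ⟩[ i ] ] S) .(rR : Reach R) .(rS : Reach S) →
              (bar-tr d rR rS ∷ fw d rR rS ∷ ε) ≍ ε

-- Every forward step of ω is pushed to the right past the backward steps that follow it.  If a
-- forward step is followed by the undoing of a step with the same key, both are the same transition
-- (a forward transition is determined by its target and its key) and the pair cancels.  With distinct
-- keys, the two undone steps can also be undone in the opposite order from a common source, and the
-- forward step is concurrent with the new backward step because a key that has just been performed is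
-- not a cause of anything in its target; so the two may be swapped.  Neither move lengthens ω.

module Submission where

open import Defs
open import Data.Bool as Bool using (Bool; true; false)
open import Data.Empty using (⊥-elim)
open import Data.Empty.Irrelevant using () renaming (⊥-elim to ⊥-elim-irr)
open import Data.List using (List; []; _∷_) renaming (_++_ to _++ˡ_)
open import Data.List.Membership.Propositional using (_∈_; lose)
open import Data.List.Membership.Propositional.Properties using (∈-++⁺ˡ; ∈-++⁺ʳ; ∈-++⁻)
import Data.List.Membership.DecPropositional as DecMembership
open import Data.List.Relation.Unary.Any as ListAny using (here; there; any?)
open import Data.Maybe as Maybe using (Maybe; just; nothing; Is-just; to-witness)
open import Data.Maybe.Relation.Unary.Any as MaybeAny using (just)
open import Data.Nat as ℕ using (ℕ; suc; _+_; _≤_; _<_; z≤n; s≤s)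
open import Data.Nat.Induction using (<-wellFounded)
open import Data.Nat.Properties using (module ≤-Reasoning; ≤-refl; ≤-trans; ≤-reflexive; +-identityʳ; +-comm; +-assoc; m≤n+m; +-monoˡ-≤; +-monoˡ-<; +-monoʳ-<; +-mono-<)
open import Data.Product using (Σ; ∃; _×_; _,_; -,_; proj₂; uncurry)
open import Data.Sum using (inj₁; inj₂; [_,_]′)
open import Data.Unit using (tt)
open import Function using (_∘_)
open import Function.Bundles using (mk↣)
open import Induction.WellFounded using (Acc; acc)
open import Relation.Binary.Bundles using (Setoid)
open import Relation.Binary.Definitions using (DecidableEquality)
import Relation.Binary.Reasoning.Setoid as SetoidReasoning
open import Relation.Nullary using (¬_; Dec; yes; no)
open import Relation.Nullary.Decidable using (_×-dec_; map′; via-injection)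
open import Relation.Nullary.Recomputable using (Recomputable)
open import Relation.Binary.PropositionalEquality using (_≡_; _≢_; refl; sym; trans; cong; cong₂; subst; module ≡-Reasoning)

module _ (sig : Sig) where
  open Sig sig
  open RMPC sig

  variable
    R R₁ R₂ S T U : Proc
    a b : Act
    r m : Rate
    i j k : Key
    ℓ ℓ′ : Label
    L : Act → Bool

  _≟ᴷ_ : DecidableEquality Key
  _≟ᴷ_ = via-injection (mk↣ (proj₂ Key-countable)) ℕ._≟_

  std⇒∉key : Std R → ¬ (i ∈key R)
  std⇒∉key (stdPre s) (kPre p) = std⇒∉key s p
  std⇒∉key (stdSum s _) (kSumL p) = std⇒∉key s p
  std⇒∉key (stdSum _ s) (kSumR p) = std⇒∉key s p
  std⇒∉key (stdPar s _) (kParL p) = std⇒∉key s p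
  std⇒∉key (stdPar _ s) (kParR p) = std⇒∉key s p

  ⟶-key : R ⟶[ ⟨ a , r ⟩[ i ] ] S → i ∈key S
  ⟶-key (act1 _ _) = kHere
  ⟶-key (act2 d _) = kThere (⟶-key d)
  ⟶-key (choL d _) = kSumL (⟶-key d)
  ⟶-key (choR d _) = kSumR (⟶-key d)
  ⟶-key (parL d _ _) = kParL (⟶-key d)
  ⟶-key (parR d _ _) = kParR (⟶-key d)
  ⟶-key (coo d _ _) = kParL (⟶-key d)

  ⟶-keeps-key : R ⟶[ ℓ ] S → k ∈key R → k ∈key S
  ⟶-keeps-key (act1 _ _) (kPre p) = kThere p
  ⟶-keeps-key (act2 d _) kHere = kHere
  ⟶-keeps-key (act2 d _) (kThere p) = kThere (⟶-keeps-key d p)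
  ⟶-keeps-key (choL d _) (kSumL p) = kSumL (⟶-keeps-key d p)
  ⟶-keeps-key (choL d _) (kSumR p) = kSumR p
  ⟶-keeps-key (choR d _) (kSumL p) = kSumL p
  ⟶-keeps-key (choR d _) (kSumR p) = kSumR (⟶-keeps-key d p)
  ⟶-keeps-key (parL d _ _) (kParL p) = kParL (⟶-keeps-key d p)
  ⟶-keeps-key (parL d _ _) (kParR p) = kParR p
  ⟶-keeps-key (parR d _ _) (kParL p) = kParL p
  ⟶-keeps-key (parR d _ _) (kParR p) = kParR (⟶-keeps-key d p)
  ⟶-keeps-key (coo d _ _) (kParL p) = kParL (⟶-keeps-key d p)
  ⟶-keeps-key (coo _ e _) (kParR p) = kParR (⟶-keeps-key e p)

  InCau⇒∈key : InCau k R i → k ∈key R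
  InCau⇒∈key (cPre _ _ (inj₁ refl)) = kHere
  InCau⇒∈key (cPre _ _ (inj₂ c)) = kThere (InCau⇒∈key c)
  InCau⇒∈key (cSumL c) = kSumL (InCau⇒∈key c)
  InCau⇒∈key (cSumR c) = kSumR (InCau⇒∈key c)
  InCau⇒∈key (cParL c) = kParL (InCau⇒∈key c)
  InCau⇒∈key (cParR c) = kParR (InCau⇒∈key c)

  ⟶-key-uncaused : R ⟶[ ⟨ a , r ⟩[ j ] ] S → ¬ InCau j S i
  ⟶-key-uncaused (act1 _ s) (cPre _ i∈R _) = ⊥-elim-irr (std⇒∉key s i∈R)
  ⟶-key-uncaused (act2 d j≢k) (cPre _ _ (inj₁ refl)) = ⊥-elim-irr (j≢k refl)
  ⟶-key-uncaused (act2 d _) (cPre _ _ (inj₂ c)) = ⟶-key-uncaused d c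
  ⟶-key-uncaused (choL d _) (cSumL c) = ⟶-key-uncaused d c
  ⟶-key-uncaused (choL d s) (cSumR c) = ⊥-elim-irr (std⇒∉key s (InCau⇒∈key c))
  ⟶-key-uncaused (choR d s) (cSumL c) = ⊥-elim-irr (std⇒∉key s (InCau⇒∈key c))
  ⟶-key-uncaused (choR d _) (cSumR c) = ⟶-key-uncaused d c
  ⟶-key-uncaused (parL d _ _) (cParL c) = ⟶-key-uncaused d c
  ⟶-key-uncaused (parL d _ j∉) (cParR c) = ⊥-elim-irr (j∉ (InCau⇒∈key c))
  ⟶-key-uncaused (parR d _ j∉) (cParL c) = ⊥-elim-irr (j∉ (InCau⇒∈key c))
  ⟶-key-uncaused (parR d _ _) (cParR c) = ⟶-key-uncaused d c
  ⟶-key-uncaused (coo d _ _) (cParL c) = ⟶-key-uncaused d c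
  ⟶-key-uncaused (coo _ e _) (cParR c) = ⟶-key-uncaused e c

  data SameStep (d : R ⟶[ ℓ ] S) : R₁ ⟶[ ℓ′ ] S → Set where
    same : SameStep d d

  target-key-unique : (d : R ⟶[ ⟨ a , r ⟩[ i ] ] S) (x : R₁ ⟶[ ⟨ b , m ⟩[ i ] ] S) → SameStep d x
  target-key-unique (act1 _ _) (act1 _ _) = same
  target-key-unique (act1 _ _) (act2 _ i≢i) = ⊥-elim-irr (i≢i refl)
  target-key-unique (act2 _ i≢i) (act1 _ _) = ⊥-elim-irr (i≢i refl)
  target-key-unique (act2 d _) (act2 x _) with target-key-unique d x
  ... | same = same
  target-key-unique (choL d _) (choL x _) with target-key-unique d x
  ... | same = same
  target-key-unique (choL d _) (choR _ s) = ⊥-elim-irr (std⇒∉key s (⟶-key d))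
  target-key-unique (choR d _) (choL _ s) = ⊥-elim-irr (std⇒∉key s (⟶-key d))
  target-key-unique (choR d _) (choR x _) with target-key-unique d x
  ... | same = same
  target-key-unique (parL d _ _) (parL x _ _) with target-key-unique d x
  ... | same = same
  target-key-unique (parL _ _ i∉) (parR x _ _) = ⊥-elim-irr (i∉ (⟶-key x))
  target-key-unique (parL _ _ i∉) (coo _ x _) = ⊥-elim-irr (i∉ (⟶-key x))
  target-key-unique (parR _ _ i∉) (parL x _ _) = ⊥-elim-irr (i∉ (⟶-key x))
  target-key-unique (parR d _ _) (parR x _ _) with target-key-unique d x
  ... | same = same
  target-key-unique (parR _ _ i∉) (coo x _ _) = ⊥-elim-irr (i∉ (⟶-key x))
  target-key-unique (coo _ d _) (parL _ _ i∉) = ⊥-elim-irr (i∉ (⟶-key d))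
  target-key-unique (coo d _ _) (parR _ _ i∉) = ⊥-elim-irr (i∉ (⟶-key d))
  target-key-unique (coo d e _) (coo x y _) with target-key-unique d x | target-key-unique e y
  ... | same | same = same

  cofinal-square : (d : R₁ ⟶[ ⟨ a , r ⟩[ i ] ] S) (x : R₂ ⟶[ ⟨ b , m ⟩[ j ] ] S) → i ≢ j →
    Σ Proc λ U → Σ (U ⟶[ ⟨ b , m ⟩[ j ] ] R₁) λ x′ → U ⟶[ ⟨ a , r ⟩[ i ] ] R₂ × brate x′ ≡ brate x
  cofinal-square (act1 _ _) (act1 _ _) i≢j = ⊥-elim (i≢j refl)
  cofinal-square (act1 _ s) (act2 x _) _ = ⊥-elim-irr (std⇒∉key s (⟶-key x))
  cofinal-square (act2 d _) (act1 _ s) _ = ⊥-elim-irr (std⇒∉key s (⟶-key d))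
  cofinal-square (act2 d p) (act2 x q) i≢j with cofinal-square d x i≢j
  ... | U , x′ , d′ , eq = -, act2 x′ q , act2 d′ p , eq
  cofinal-square (choL d s) (choL x _) i≢j with cofinal-square d x i≢j
  ... | U , x′ , d′ , eq = -, choL x′ s , choL d′ s , eq
  cofinal-square (choL d _) (choR _ s) _ = ⊥-elim-irr (std⇒∉key s (⟶-key d))
  cofinal-square (choR d _) (choL _ s) _ = ⊥-elim-irr (std⇒∉key s (⟶-key d))
  cofinal-square (choR d s) (choR x _) i≢j with cofinal-square d x i≢j
  ... | U , x′ , d′ , eq = -, choR x′ s , choR d′ s , eq
  cofinal-square (parL d p i∉) (parL x q j∉) i≢j with cofinal-square d x i≢j
  ... | U , x′ , d′ , eq = -, parL x′ q j∉ , parL d′ p i∉ , eq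
  cofinal-square (parL d p i∉) (parR x q j∉) _ =
    -, parR x q (j∉ ∘ ⟶-keeps-key d) , parL d p (i∉ ∘ ⟶-keeps-key x) , refl
  cofinal-square (parL d p i∉) (coo x y q) i≢j with cofinal-square d x i≢j
  ... | U , x′ , d′ , eq = -, coo x′ y q , parL d′ p (i∉ ∘ ⟶-keeps-key y) , cong (_· brate y) eq
  cofinal-square (parR d p i∉) (parL x q j∉) _ =
    -, parL x q (j∉ ∘ ⟶-keeps-key d) , parR d p (i∉ ∘ ⟶-keeps-key x) , refl
  cofinal-square (parR d p i∉) (parR x q j∉) i≢j with cofinal-square d x i≢j
  ... | U , x′ , d′ , eq = -, parR x′ q j∉ , parR d′ p i∉ , eq
  cofinal-square (parR d p i∉) (coo x y q) i≢j with cofinal-square d y i≢j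
  ... | U , y′ , d′ , eq = -, coo x y′ q , parR d′ p (i∉ ∘ ⟶-keeps-key x) , cong (brate x ·_) eq
  cofinal-square (coo d e p) (parL x q j∉) i≢j with cofinal-square d x i≢j
  ... | U , x′ , d′ , eq = -, parL x′ q (j∉ ∘ ⟶-keeps-key e) , coo d′ e p , eq
  cofinal-square (coo d e p) (parR x q j∉) i≢j with cofinal-square e x i≢j
  ... | U , x′ , e′ , eq = -, parR x′ q (j∉ ∘ ⟶-keeps-key d) , coo d e′ p , eq
  cofinal-square (coo d e p) (coo x y q) i≢j with cofinal-square d x i≢j | cofinal-square e y i≢j
  ... | U , x′ , d′ , eq | V , y′ , e′ , eq′ = -, coo x′ y′ q , coo d′ e′ p , cong₂ _·_ eq eq′

  data Reversal : S ⇝[ ℓ ] T → Set where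
    reversal : (d : T ⟶[ ⟨ a , r ⟩[ i ] ] S) → Reversal (revD d)

  ⇝-reversal : (e : S ⇝[ ℓ ] T) → Reversal e
  ⇝-reversal (act1ʳ {i = i} s) = reversal (act1 i s)
  ⇝-reversal (act2ʳ e p) with ⇝-reversal e
  ... | reversal d = reversal (act2 d p)
  ⇝-reversal (choLʳ e s) with ⇝-reversal e
  ... | reversal d = reversal (choL d s)
  ⇝-reversal (choRʳ e s) with ⇝-reversal e
  ... | reversal d = reversal (choR d s)
  ⇝-reversal (parLʳ e p q) with ⇝-reversal e
  ... | reversal d = reversal (parL d p q)
  ⇝-reversal (parRʳ e p q) with ⇝-reversal e
  ... | reversal d = reversal (parR d p q)
  ⇝-reversal (cooʳ e f p) with ⇝-reversal e | ⇝-reversal f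
  ... | reversal d | reversal g = reversal (coo d g p)

  ⇝-key : S ⇝[ ⟨ a , r ⟩[ i ] ] T → i ∈key S
  ⇝-key e with ⇝-reversal e
  ... | reversal d = ⟶-key d

  reach-pred : Reach S → R ⟶[ ⟨ a , r ⟩[ i ] ] S → Reach R
  reach-pred (base s) d = ⊥-elim (std⇒∉key s (⟶-key d))
  reach-pred {i = i} (step {ℓ = ⟨ _ , _ ⟩[ j ]} rR₀ d₀) d with j ≟ᴷ i
  ... | yes refl with target-key-unique d₀ d
  ...   | same = rR₀
  reach-pred (step rR₀ d₀) d | no j≢i with cofinal-square d₀ d j≢i
  ... | _ , x′ , d′ , _ = step (reach-pred rR₀ x′) d′

  -- Computations record reachability only irrelevantly, but forward computations need it relevantly.
  -- It is recomputed by undoing steps until a standard process is reached: a reachable process that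
  -- is not standard can undo its last step, so a search over its keys finds an undoable one.

  _≟ᴬ_ : DecidableEquality Act
  _≟ᴬ_ = via-injection (mk↣ (proj₂ Act-countable)) ℕ._≟_

  open DecMembership _≟ᴷ_ using (_∈?_)

  std? : (R : Proc) → Dec (Std R)
  std? 𝟎 = yes std𝟎
  std? (⟨ a , r ⟩· R) = map′ stdPre (λ { (stdPre s) → s }) (std? R)
  std? (⟨ a , r ⟩[ i ]· R) = no λ ()
  std? (R +ₚ S) = map′ (uncurry stdSum) (λ { (stdSum s t) → s , t }) (std? R ×-dec std? S)
  std? (R ∥[ L ] S) = map′ (uncurry stdPar) (λ { (stdPar s t) → s , t }) (std? R ×-dec std? S)

  keys : Proc → List Key
  keys 𝟎 = []
  keys (⟨ a , r ⟩· R) = keys R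
  keys (⟨ a , r ⟩[ i ]· R) = i ∷ keys R
  keys (R +ₚ S) = keys R ++ˡ keys S
  keys (R ∥[ L ] S) = keys R ++ˡ keys S

  ∈key⇒∈keys : i ∈key R → i ∈ keys R
  ∈key⇒∈keys kHere = here refl
  ∈key⇒∈keys (kThere p) = there (∈key⇒∈keys p)
  ∈key⇒∈keys (kPre p) = ∈key⇒∈keys p
  ∈key⇒∈keys (kSumL p) = ∈-++⁺ˡ (∈key⇒∈keys p)
  ∈key⇒∈keys (kSumR {R = R} p) = ∈-++⁺ʳ (keys R) (∈key⇒∈keys p)
  ∈key⇒∈keys (kParL p) = ∈-++⁺ˡ (∈key⇒∈keys p)
  ∈key⇒∈keys (kParR {R = R} p) = ∈-++⁺ʳ (keys R) (∈key⇒∈keys p)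

  ∈keys⇒∈key : ∀ R → i ∈ keys R → i ∈key R
  ∈keys⇒∈key (⟨ a , r ⟩· R) p = kPre (∈keys⇒∈key R p)
  ∈keys⇒∈key (⟨ a , r ⟩[ _ ]· R) (here refl) = kHere
  ∈keys⇒∈key (⟨ a , r ⟩[ _ ]· R) (there p) = kThere (∈keys⇒∈key R p)
  ∈keys⇒∈key (R +ₚ S) p = [ kSumL ∘ ∈keys⇒∈key R , kSumR ∘ ∈keys⇒∈key S ]′ (∈-++⁻ (keys R) p)
  ∈keys⇒∈key (R ∥[ L ] S) p = [ kParL ∘ ∈keys⇒∈key R , kParR ∘ ∈keys⇒∈key S ]′ (∈-++⁻ (keys R) p)

  _∈key?_ : (i : Key) (R : Proc) → Dec (i ∈key R)
  i ∈key? R = map′ (∈keys⇒∈key R) ∈key⇒∈keys (i ∈? keys R)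

  data Undo (i : Key) (R : Proc) : Set where
    undone : R ⇝[ ⟨ a , r ⟩[ i ] ] T → Undo i R

  actionOf : Undo i R → Act
  actionOf (undone {a = a} _) = a

  undo-∥ : Dec (i ∈key R) → Dec (i ∈key S) → Maybe (Undo i R) → Maybe (Undo i S) →
           Maybe (Undo i (R ∥[ L ] S))
  undo-∥ {L = L} (yes _) (no i∉S) (just (undone {a = a} e)) _ with L a Bool.≟ false
  ... | yes p = just (undone (parLʳ e p i∉S))
  ... | no _ = nothing
  undo-∥ {L = L} (no i∉R) (yes _) _ (just (undone {a = a} e)) with L a Bool.≟ false
  ... | yes p = just (undone (parRʳ e p i∉R))
  ... | no _ = nothing
  undo-∥ {L = L} (yes _) (yes _) (just (undone {a = a} e)) (just (undone {a = a′} f))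
    with a ≟ᴬ a′ | L a Bool.≟ true
  ... | yes refl | yes p = just (undone (cooʳ e f p))
  ... | _ | _ = nothing
  undo-∥ _ _ _ _ = nothing

  undo : (i : Key) (R : Proc) → Maybe (Undo i R)
  undo i 𝟎 = nothing
  undo i (⟨ a , r ⟩· R) = nothing
  undo i (⟨ a , r ⟩[ k ]· R) with k ≟ᴷ i | std? R
  ... | yes refl | yes s = just (undone (act1ʳ s))
  ... | yes refl | no _ = nothing
  ... | no k≢i | _ = Maybe.map (λ { (undone e) → undone (act2ʳ e (k≢i ∘ sym)) }) (undo i R)
  undo i (R +ₚ S) with std? S | std? R
  ... | yes s | _ = Maybe.map (λ { (undone e) → undone (choLʳ e s) }) (undo i R)
  ... | no _ | yes s = Maybe.map (λ { (undone e) → undone (choRʳ e s) }) (undo i S)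
  ... | no _ | no _ = nothing
  undo i (R ∥[ L ] S) = undo-∥ (i ∈key? R) (i ∈key? S) (undo i R) (undo i S)

  undo-complete : R ⇝[ ⟨ a , r ⟩[ i ] ] T → MaybeAny.Any (λ u → actionOf u ≡ a) (undo i R)
  undo-complete {R = ⟨ _ , _ ⟩[ k ]· R} (act1ʳ s) with k ≟ᴷ k | std? R
  ... | no k≢k | _ = ⊥-elim (k≢k refl)
  ... | yes refl | yes _ = just refl
  ... | yes refl | no ¬s = ⊥-elim-irr (¬s s)
  undo-complete {R = ⟨ _ , _ ⟩[ k ]· R} {i = i} (act2ʳ e i≢k) with k ≟ᴷ i | std? R
  ... | yes refl | _ = ⊥-elim-irr (i≢k refl)
  ... | no _ | _ with undo i R | undo-complete e
  ...   | just (undone _) | just refl = just refl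
  undo-complete {R = R +ₚ S} {i = i} (choLʳ e s) with std? S
  ... | no ¬s = ⊥-elim-irr (¬s s)
  ... | yes _ with undo i R | undo-complete e
  ...   | just (undone _) | just refl = just refl
  undo-complete {R = R +ₚ S} {i = i} (choRʳ e s) with std? S | std? R
  ... | yes sS | _ = ⊥-elim (std⇒∉key sS (⇝-key e))
  ... | no _ | no ¬s = ⊥-elim-irr (¬s s)
  ... | no _ | yes _ with undo i S | undo-complete e
  ...   | just (undone _) | just refl = just refl
  undo-complete {R = R ∥[ L ] S} {a = a} {i = i} (parLʳ e p i∉S)
    with i ∈key? R | i ∈key? S | undo i R | undo-complete e
  ... | no i∉R | _ | _ | _ = ⊥-elim (i∉R (⇝-key e))
  ... | yes _ | yes i∈S | _ | _ = ⊥-elim-irr (i∉S i∈S)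
  ... | yes _ | no _ | just (undone _) | just refl with L a Bool.≟ false
  ...   | yes _ = just refl
  ...   | no ¬p = ⊥-elim-irr (¬p p)
  undo-complete {R = R ∥[ L ] S} {a = a} {i = i} (parRʳ e p i∉R)
    with i ∈key? R | i ∈key? S | undo i S | undo-complete e
  ... | _ | no i∉S | _ | _ = ⊥-elim (i∉S (⇝-key e))
  ... | yes i∈R | yes _ | _ | _ = ⊥-elim-irr (i∉R i∈R)
  ... | no _ | yes _ | just (undone _) | just refl with L a Bool.≟ false
  ...   | yes _ = just refl
  ...   | no ¬p = ⊥-elim-irr (¬p p)
  undo-complete {R = R ∥[ L ] S} {a = a} {i = i} (cooʳ e f p)
    with i ∈key? R | i ∈key? S | undo i R | undo-complete e | undo i S | undo-complete f
  ... | no i∉R | _ | _ | _ | _ | _ = ⊥-elim (i∉R (⇝-key e))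
  ... | yes _ | no i∉S | _ | _ | _ | _ = ⊥-elim (i∉S (⇝-key f))
  ... | yes _ | yes _ | just (undone _) | just refl | just (undone _) | just refl
    with a ≟ᴬ a | L a Bool.≟ true
  ...   | no a≢a | _ = ⊥-elim (a≢a refl)
  ...   | yes refl | yes _ = just refl
  ...   | yes refl | no ¬p = ⊥-elim-irr (¬p p)

  last-step-undoable : Reach R → ¬ Std R → ListAny.Any (λ i → Is-just (undo i R)) (keys R)
  last-step-undoable (base s) ¬s = ⊥-elim (¬s s)
  last-step-undoable (step {ℓ = ⟨ _ , _ ⟩[ _ ]} _ d) _ =
    lose (∈key⇒∈keys (⟶-key d)) (MaybeAny.map (λ _ → tt) (undo-complete (revD d)))

  undo-some : (R : Proc) → .(Reach R) → ¬ Std R → ∃ λ i → Undo i R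
  undo-some R rR ¬s with any? (λ i → MaybeAny.dec (λ _ → yes tt) (undo i R)) (keys R)
  ... | yes found = let i , u = ListAny.satisfied found in i , to-witness u
  ... | no none = ⊥-elim-irr (none (last-step-undoable rR ¬s))

  #keyed : Proc → ℕ
  #keyed 𝟎 = 0
  #keyed (⟨ a , r ⟩· R) = #keyed R
  #keyed (⟨ a , r ⟩[ i ]· R) = suc (#keyed R)
  #keyed (R +ₚ S) = #keyed R + #keyed S
  #keyed (R ∥[ L ] S) = #keyed R + #keyed S

  ⟶-#keyed : R ⟶[ ℓ ] S → #keyed R < #keyed S
  ⟶-#keyed (act1 _ _) = ≤-refl
  ⟶-#keyed (act2 d _) = s≤s (⟶-#keyed d)
  ⟶-#keyed (choL {S = S} d _) = +-monoˡ-< (#keyed S) (⟶-#keyed d)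
  ⟶-#keyed (choR {R = R} d _) = +-monoʳ-< (#keyed R) (⟶-#keyed d)
  ⟶-#keyed (parL {S = S} d _ _) = +-monoˡ-< (#keyed S) (⟶-#keyed d)
  ⟶-#keyed (parR {R = R} d _ _) = +-monoʳ-< (#keyed R) (⟶-#keyed d)
  ⟶-#keyed (coo d e _) = +-mono-< (⟶-#keyed d) (⟶-#keyed e)

  Reach-recomputable′ : Acc _<_ (#keyed R) → Recomputable (Reach R)
  Reach-recomputable′ {R} (acc smaller) rR with std? R
  ... | yes s = base s
  ... | no ¬s with undo-some R rR ¬s
  ...   | _ , undone e with ⇝-reversal e
  ...     | reversal d = step (Reach-recomputable′ (smaller (⟶-#keyed d)) (reach-pred rR d)) d

  Reach-recomputable : Recomputable (Reach R)
  Reach-recomputable = Reach-recomputable′ (<-wellFounded _)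

  ++-identityʳ : (ω : Comp R S) → ω ++ ε ≡ ω
  ++-identityʳ ε = refl
  ++-identityʳ (θ ∷ ω) = cong (θ ∷_) (++-identityʳ ω)

  ++-assoc : (ω₁ : Comp R S) (ω₂ : Comp S T) (ω₃ : Comp T U) → (ω₁ ++ ω₂) ++ ω₃ ≡ ω₁ ++ (ω₂ ++ ω₃)
  ++-assoc ε ω₂ ω₃ = refl
  ++-assoc (θ ∷ ω₁) ω₂ ω₃ = cong (θ ∷_) (++-assoc ω₁ ω₂ ω₃)

  ∣++∣ : (ω₁ : Comp R S) (ω₂ : Comp S T) → ∣ ω₁ ++ ω₂ ∣ ≡ ∣ ω₁ ∣ + ∣ ω₂ ∣
  ∣++∣ ε ω₂ = refl
  ∣++∣ (θ ∷ ω₁) ω₂ = cong suc (∣++∣ ω₁ ω₂)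

  infixr 5 _++ᶠ_
  _++ᶠ_ : FComp R S → FComp S T → FComp R T
  ε ++ᶠ ψ₂ = ψ₂
  (t ∷ ψ₁) ++ᶠ ψ₂ = t ∷ (ψ₁ ++ᶠ ψ₂)

  toComp-++ᶠ : (ψ₁ : FComp R S) (ψ₂ : FComp S T) → toComp (ψ₁ ++ᶠ ψ₂) ≡ toComp ψ₁ ++ toComp ψ₂
  toComp-++ᶠ ε ψ₂ = refl
  toComp-++ᶠ ((d , rR , rS) ∷ ψ₁) ψ₂ = cong (fw d rR rS ∷_) (toComp-++ᶠ ψ₁ ψ₂)

  ∣++ᶠ∣ : (ψ₁ : FComp R S) (ψ₂ : FComp S T) → ∣ ψ₁ ++ᶠ ψ₂ ∣f ≡ ∣ ψ₁ ∣f + ∣ ψ₂ ∣f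
  ∣++ᶠ∣ ψ₁ ψ₂ = trans (cong ∣_∣ (toComp-++ᶠ ψ₁ ψ₂)) (∣++∣ (toComp ψ₁) (toComp ψ₂))

  barC-++ᶠ : (ψ₁ : FComp R S) (ψ₂ : FComp S T) → barC (ψ₁ ++ᶠ ψ₂) ≡ barC ψ₂ ++ barC ψ₁
  barC-++ᶠ ε ψ₂ = sym (++-identityʳ (barC ψ₂))
  barC-++ᶠ ((d , rR , rS) ∷ ψ₁) ψ₂ = begin
    barC (ψ₁ ++ᶠ ψ₂) ++ θ̄             ≡⟨ cong (_++ θ̄) (barC-++ᶠ ψ₁ ψ₂) ⟩
    (barC ψ₂ ++ barC ψ₁) ++ θ̄          ≡⟨ ++-assoc (barC ψ₂) (barC ψ₁) θ̄ ⟩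
    barC ψ₂ ++ (barC ψ₁ ++ θ̄)          ∎
    where
    open ≡-Reasoning
    θ̄ = bar-tr d rR rS ∷ ε

  ≍-setoid : Proc → Proc → Setoid _ _
  ≍-setoid R S = record
    { Carrier = Comp R S
    ; _≈_ = _≍_
    ; isEquivalence = record { refl = ≍-refl ; sym = ≍-sym ; trans = ≍-trans }
    }

  module ≍-Reasoning {R S : Proc} = SetoidReasoning (≍-setoid R S)

  ≡⇒≍ : {ω ω′ : Comp R S} → ω ≡ ω′ → ω ≍ ω′
  ≡⇒≍ refl = ≍-refl

  ≍-prefix : (θ : Tr R S) {ω ω′ : Comp S T} → ω ≍ ω′ → (θ ∷ ω) ≍ (θ ∷ ω′)
  ≍-prefix θ = ≍-comp {ω₁ = θ ∷ ε} ≍-refl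

  -- A backward computation, stored as the reachable forward transitions it undoes.
  infixr 5 _∷_
  data BComp : Proc → Proc → Set where
    ε : BComp R R
    _∷_ : Σ (S ⟶[ ⟨ a , r ⟩[ i ] ] R) (λ _ → Reach S × Reach R) → BComp S T → BComp R T

  bwComp : BComp R T → Comp R T
  bwComp ε = ε
  bwComp ((d , rS , rR) ∷ β) = bar-tr d rS rR ∷ bwComp β

  reverseᵇ : BComp R T → FComp T R
  reverseᵇ ε = ε
  reverseᵇ (t ∷ β) = reverseᵇ β ++ᶠ (t ∷ ε)

  barC-reverseᵇ : (β : BComp R T) → barC (reverseᵇ β) ≡ bwComp β
  barC-reverseᵇ ε = refl
  barC-reverseᵇ ((d , rS , rR) ∷ β) =
    trans (barC-++ᶠ (reverseᵇ β) _) (cong (bar-tr d rS rR ∷_) (barC-reverseᵇ β))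

  ∣reverseᵇ∣ : (β : BComp R T) → ∣ reverseᵇ β ∣f ≡ ∣ bwComp β ∣
  ∣reverseᵇ∣ ε = refl
  ∣reverseᵇ∣ (t ∷ β) =
    trans (∣++ᶠ∣ (reverseᵇ β) (t ∷ ε)) (trans (+-comm (∣ reverseᵇ β ∣f) 1) (cong suc (∣reverseᵇ∣ β)))

  record ParabolicForm (ω : Comp R S) : Set where
    constructor parabolic
    field
      {apex} : Proc
      backward : BComp R apex
      forward : FComp apex S
      ≍-form : ω ≍ bwComp backward ++ toComp forward
      ∣form∣≤ : ∣ bwComp backward ∣ + ∣ forward ∣f ≤ ∣ ω ∣

  ⟶-past-undos : (d : R ⟶[ ⟨ a , r ⟩[ i ] ] R₁) (rR : Reach R) (rR₁ : Reach R₁) (β : BComp R₁ T) →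
                 ParabolicForm (fw d rR rR₁ ∷ bwComp β)
  ⟶-past-undos d rR rR₁ ε = parabolic ε ((d , rR , rR₁) ∷ ε) ≍-refl ≤-refl
  ⟶-past-undos {i = i} d rR rR₁ (_∷_ {i = j} (x , rR₂ , _) β) with i ≟ᴷ j
  ... | yes refl with target-key-unique d x
  ...   | same = parabolic β ε cancel (≤-trans (≤-reflexive (+-identityʳ _)) (m≤n+m _ 2))
    where
    cancel : fw d rR rR₁ ∷ bar-tr d rR rR₁ ∷ bwComp β ≍ bwComp β ++ ε
    cancel = ≍-trans (≍-comp (≍-cancel d rR rR₁) ≍-refl) (≡⇒≍ (sym (++-identityʳ (bwComp β))))
  ⟶-past-undos d rR rR₁ ((x , rR₂ , _) ∷ β) | no i≢j with cofinal-square d x i≢j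
  ... | U , x′ , d′ , brate≡ with ⟶-past-undos d′ (reach-pred rR x′) rR₂ β
  ...   | parabolic β′ ψ ≍′ ∣≤∣ = parabolic ((x′ , rU , rR) ∷ β′) ψ swapped (s≤s ∣≤∣)
    where
    rU = reach-pred rR x′
    open ≍-Reasoning
    swapped : fw d rR rR₁ ∷ bar-tr x rR₂ rR₁ ∷ bwComp β ≍ bar-tr x′ rU rR ∷ bwComp β′ ++ toComp ψ
    swapped = begin
      fw d rR rR₁ ∷ bar-tr x rR₂ rR₁ ∷ bwComp β
        ≈⟨ ≍-comp (≍-swap (fw d rR rR₁) (bar-tr x′ rU rR) (bar-tr x rR₂ rR₁) (fw d′ rU rR₂)
                          (λ { (conf1 c) → ⟶-key-uncaused x c })
                          refl (cong (λ ρ → bwd , ⟨ _ , ρ ⟩[ _ ]) (sym brate≡)))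
                  ≍-refl ⟩
      bar-tr x′ rU rR ∷ fw d′ rU rR₂ ∷ bwComp β
        ≈⟨ ≍-prefix (bar-tr x′ rU rR) ≍′ ⟩
      bar-tr x′ rU rR ∷ bwComp β′ ++ toComp ψ ∎

  parabolic-from : Reach R → (ω : Comp R S) → ParabolicForm ω
  parabolic-from rR ε = parabolic ε ε ≍-refl z≤n
  parabolic-from rR (fw {⟨ _ , _ ⟩[ _ ]} d x y ∷ ω) with parabolic-from (step rR d) ω
  ... | parabolic β ψ ≍ω ∣≤∣ with ⟶-past-undos d rR (step rR d) β
  ...   | parabolic β′ ψ′ ≍′ ∣≤∣′ = parabolic β′ (ψ′ ++ᶠ ψ) pushed bound
    where
    pushed : fw d x y ∷ ω ≍ bwComp β′ ++ toComp (ψ′ ++ᶠ ψ)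
    pushed = begin
      fw d x y ∷ ω                                ≈⟨ ≍-prefix (fw d x y) ≍ω ⟩
      (fw d x y ∷ bwComp β) ++ toComp ψ           ≈⟨ ≍-comp ≍′ ≍-refl ⟩
      (bwComp β′ ++ toComp ψ′) ++ toComp ψ        ≡⟨ ++-assoc (bwComp β′) (toComp ψ′) (toComp ψ) ⟩
      bwComp β′ ++ (toComp ψ′ ++ toComp ψ)        ≡⟨ cong (bwComp β′ ++_) (sym (toComp-++ᶠ ψ′ ψ)) ⟩
      bwComp β′ ++ toComp (ψ′ ++ᶠ ψ)              ∎
      where open ≍-Reasoning
    bound : ∣ bwComp β′ ∣ + ∣ ψ′ ++ᶠ ψ ∣f ≤ suc ∣ ω ∣
    bound = begin
      ∣ bwComp β′ ∣ + ∣ ψ′ ++ᶠ ψ ∣f           ≡⟨ cong (∣ bwComp β′ ∣ +_) (∣++ᶠ∣ ψ′ ψ) ⟩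
      ∣ bwComp β′ ∣ + (∣ ψ′ ∣f + ∣ ψ ∣f)      ≡⟨ sym (+-assoc (∣ bwComp β′ ∣) (∣ ψ′ ∣f) (∣ ψ ∣f)) ⟩
      (∣ bwComp β′ ∣ + ∣ ψ′ ∣f) + ∣ ψ ∣f      ≤⟨ +-monoˡ-≤ (∣ ψ ∣f) ∣≤∣′ ⟩
      suc (∣ bwComp β ∣ + ∣ ψ ∣f)             ≤⟨ s≤s ∣≤∣ ⟩
      suc ∣ ω ∣                               ∎
      where open ≤-Reasoning
  parabolic-from rR (bw e x y ∷ ω) with ⇝-reversal e
  ... | reversal d with parabolic-from (reach-pred rR d) ω
  ...   | parabolic β ψ ≍ω ∣≤∣ =
    parabolic ((d , reach-pred rR d , rR) ∷ β) ψ (≍-prefix (bw (revD d) x y) ≍ω) (s≤s ∣≤∣)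

  source-reach : Tr R S → Reach R
  source-reach (fw _ x _) = Reach-recomputable x
  source-reach (bw _ x _) = Reach-recomputable x

  parabolic-lemma : (ω : Comp R S) →
    Σ Proc λ T → Σ (FComp T R) λ ω₁ → Σ (FComp T S) λ ω₂ →
      (ω ≍ barC ω₁ ++ toComp ω₂) × (∣ ω₁ ∣f + ∣ ω₂ ∣f ≤ ∣ ω ∣)
  parabolic-lemma ε = -, ε , ε , ≍-refl , z≤n
  parabolic-lemma ω@(θ ∷ _) with parabolic-from (source-reach θ) ω
  ... | parabolic β ψ ≍ω ∣≤∣ =
    -, reverseᵇ β , ψ ,
    ≍-trans ≍ω (≡⇒≍ (cong (_++ toComp ψ) (sym (barC-reverseᵇ β)))) ,
    subst (λ n → n + ∣ ψ ∣f ≤ ∣ ω ∣) (sym (∣reverseᵇ∣ β)) ∣≤∣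

lemma4p9 : (sig : Sig) → let open RMPC sig in
    ∀ {R S : Proc} (ω : Comp R S) →
      Σ Proc (λ T → Σ (FComp T R) (λ ω₁ → Σ (FComp T S) (λ ω₂ →
        (ω ≍ (barC ω₁ ++ toComp ω₂)) × (∣ ω₁ ∣f + ∣ ω₂ ∣f ≤ ∣ ω ∣))))
lemma4p9 = parabolic-lemma
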